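{- Let $G=(V,E)$ be a graph on $n$ vertices and $k\ge 0$ an integer, let $c$ be a $2$-valid edge coloring of $G$ using at least $n-k$ colors, and let $H$ be a character subgraph of $G$ with respect to $c$. Let $\mathcal{P}$ be the set of endpoints of the connected components of $H$ that are paths, and let $\mathcal{T}:=V(H)\setminus\mathcal{P}$. Then every vertex $u\in V$ is adjacent in $G$ to at most six vertices of $\mathcal{T}$.
   Context: All graphs are finite, simple and undirected. An edge coloring of $G$ using $m$ colors is a surjective map $c:E\to[m]$; it is $2$-valid if for every vertex $v$ the edges incident to $v$ receive at most $2$ distinct colors. A character subgraph of $G$ with respect to $c$ is obtained by choosing, for each color $i\in[m]$, one edge $e_i$ with $c(e_i)=i$, and letting $H$ be the subgraph formed by the edges $e_1,\dots,e_m$ and their endpoints. Such $H$ has maximum degree at most $2$, so its components are paths and cycles. -}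

module Defs where

open import Data.Nat using (ℕ; _≤_; _∸_)
open import Data.Fin using (Fin; toℕ)
open import Data.Bool using (Bool; T; false)
open import Data.Product using (Σ; Σ-syntax; ∃; ∃-syntax; _×_; _,_; proj₁; proj₂)
open import Data.Sum using (_⊎_)
open import Data.List using (List; []; _∷_; length)
open import Data.List.Membership.Propositional using (_∈_)
open import Data.List.Relation.Unary.All using (All)
open import Data.List.Relation.Unary.Unique.Propositional using (Unique)
open import Relation.Binary.PropositionalEquality using (_≡_)
open import Relation.Binary.Construct.Closure.ReflexiveTransitive using (Star)
open import Relation.Nullary using (¬_)
open import Function.Bundles using (_⇔_)

record Graph (n : ℕ) : Set where
  field
    adj    : Fin n → Fin n → Bool
    sym    : ∀ u v → adj u v ≡ adj v u
    irrefl : ∀ u → adj u u ≡ false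
open Graph public

-- An edge {u,v} is represented canonically with toℕ u < toℕ v.
Edge : ∀ {n} → Graph n → Set
Edge {n} G = Σ[ u ∈ Fin n ] Σ[ v ∈ Fin n ] (Data.Nat._<_ (toℕ u) (toℕ v) × T (adj G u v))

end₁ end₂ : ∀ {n} (G : Graph n) → Edge G → Fin n
end₁ G e = proj₁ e
end₂ G e = proj₁ (proj₂ e)

Incident : ∀ {n} (G : Graph n) → Fin n → Edge G → Set
Incident G v e = (v ≡ end₁ G e) ⊎ (v ≡ end₂ G e)

Surj : ∀ {n m} (G : Graph n) → (Edge G → Fin m) → Set
Surj {m = m} G c = ∀ (i : Fin m) → ∃[ e ] (c e ≡ i)

-- 2-valid: at every vertex, the incident edges receive at most 2 distinct colors
TwoValid : ∀ {n m} (G : Graph n) → (Edge G → Fin m) → Set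
TwoValid {n} G c =
  ∀ (v : Fin n) (e₁ e₂ e₃ : Edge G) → Incident G v e₁ → Incident G v e₂ → Incident G v e₃ →
  (c e₁ ≡ c e₂) ⊎ (c e₁ ≡ c e₃) ⊎ (c e₂ ≡ c e₃)

-- A character subgraph H is given by a choice of one edge of each color.
IsCharacterChoice : ∀ {n m} (G : Graph n) → (Edge G → Fin m) → (Fin m → Edge G) → Set
IsCharacterChoice {m = m} G c sel = ∀ (i : Fin m) → c (sel i) ≡ i

module CharSub {n m : ℕ} (G : Graph n) (sel : Fin m → Edge G) where

  HEdge : Fin n → Fin n → Set
  HEdge x y = ∃[ i ] (((x ≡ end₁ G (sel i)) × (y ≡ end₂ G (sel i)))
                    ⊎ ((x ≡ end₂ G (sel i)) × (y ≡ end₁ G (sel i))))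

  InVH : Fin n → Set
  InVH v = ∃[ i ] (Incident G v (sel i))

  Reach : Fin n → Fin n → Set
  Reach = Star HEdge

  data Adjacent {A : Set} : List A → A → A → Set where
    here  : ∀ {y z ws} → Adjacent (y ∷ z ∷ ws) y z
    there : ∀ {w ws y z} → Adjacent ws y z → Adjacent (w ∷ ws) y z

  Consec : List (Fin n) → Fin n → Fin n → Set
  Consec ws y z = Adjacent ws y z ⊎ Adjacent ws z y

  -- The connected component of H containing x is a path, and x is an endpoint
  -- of it: the component's vertices can be listed without repetition as
  -- x = w₀, w₁, …, w_ℓ so that the H-edges within the component are exactly
  -- the consecutive pairs {wⱼ, wⱼ₊₁}.
  PathEndpoint : Fin n → Set
  PathEndpoint x = Σ[ rest ∈ List (Fin n) ]
    (Unique (x ∷ rest)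
    × (∀ y → Reach x y ⇔ (y ∈ x ∷ rest))
    × (∀ y z → y ∈ x ∷ rest → HEdge y z ⇔ Consec (x ∷ rest) y z))

  InT : Fin n → Set
  InT v = InVH v × ¬ PathEndpoint v

-- Let u ∈ V and let v ∈ 𝒯 be joined to u by an edge e. Then v lies on the selected edge of
-- colour c(e): otherwise, by 2-validity at v, all selected edges at v share one colour other
-- than c(e), so v has degree at most 1 in H. Selected edges have pairwise distinct colours,
-- so 2-validity also bounds every degree in H by 2, and in such a graph a vertex of degree at
-- most 1 is an endpoint of a path component, i.e. v ∈ 𝒫. As at most two colours occur at u,
-- all neighbours of u in 𝒯 lie on at most two selected edges, so there are at most four.
module Submission where

open import Defs
open import Data.Nat using (ℕ; suc; zero; _≤_; _∸_; _+_; z≤n; s≤s)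
open import Data.Nat.Properties
  using (≤-refl; ≤-trans; ≤-reflexive; <-irrefl; <-cmp; ≤⇒≯; n≤1+n; +-suc; +-identityʳ; m≤m+n)
open import Data.Fin using (Fin; toℕ; _≟_)
open import Data.Fin.Properties using (toℕ-injective; any?)
open import Data.Bool using (T)
open import Data.Empty using (⊥-elim)
open import Data.Product using (Σ-syntax; ∃-syntax; _×_; _,_; proj₁; proj₂; swap; uncurry)
open import Data.Sum using (_⊎_; inj₁; inj₂)
import Data.Sum as Sum
open import Data.List using (List; []; _∷_; _++_; _∷ʳ_; length)
open import Data.List.Properties using (length-removeAt′; length-tabulate)
open import Data.List.Relation.Unary.All as All using (All; []; _∷_)
open import Data.List.Relation.Unary.All.Properties using (¬All⇒Any¬)
open import Data.List.Relation.Unary.Any using (here; there; _─_; index)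
open import Data.List.Relation.Unary.AllPairs using ([]; _∷_)
open import Data.List.Relation.Unary.Unique.Propositional using (Unique)
open import Data.List.Relation.Unary.Unique.Propositional.Properties using (++⁺)
open import Data.List.Relation.Binary.Subset.Propositional using (_⊆_)
open import Data.List.Membership.Propositional using (_∈_; _∉_; find)
open import Data.List.Membership.Propositional.Properties using (∈-allFin; ∈-++⁺ˡ; ∈-++⁺ʳ; ∈-++⁻)
open import Relation.Binary.PropositionalEquality as ≡ using (_≡_; _≢_; refl; trans; cong; subst; ≢-sym)
open import Relation.Binary.Construct.Closure.ReflexiveTransitive using (Star; ε; _◅_)
open import Relation.Binary.Definitions using (tri<; tri≈; tri>)
open import Relation.Nullary using (¬_; Dec; yes; no)
open import Relation.Nullary.Decidable using (_×-dec_; _⊎-dec_; ¬?; decidable-stable)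
open import Function.Bundles using (mk⇔)

module _ {A : Set} where

  ∈-─ : ∀ {x y : A} {ys} → y ∈ ys → y ≢ x → (x∈ys : x ∈ ys) → y ∈ (ys ─ x∈ys)
  ∈-─ (here refl)  y≢x (here refl)  = ⊥-elim (y≢x refl)
  ∈-─ (here y≡z)   _   (there _)    = here y≡z
  ∈-─ (there y∈ys) _   (here _)     = y∈ys
  ∈-─ (there y∈ys) y≢x (there x∈ys) = there (∈-─ y∈ys y≢x x∈ys)

  Unique-⊆⇒length≤ : ∀ {xs ys : List A} → Unique xs → xs ⊆ ys → length xs ≤ length ys
  Unique-⊆⇒length≤ [] _ = z≤n
  Unique-⊆⇒length≤ {x ∷ xs} {ys} (x≢xs ∷ xs!) x∷xs⊆ys =
    ≤-trans (s≤s (Unique-⊆⇒length≤ xs! xs⊆ys─x))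
            (≤-reflexive (≡.sym (length-removeAt′ ys (index x∈ys))))
    where
    x∈ys : x ∈ ys
    x∈ys = x∷xs⊆ys (here refl)
    xs⊆ys─x : xs ⊆ (ys ─ x∈ys)
    xs⊆ys─x y∈xs = ∈-─ (x∷xs⊆ys (there y∈xs)) (≢-sym (All.lookup x≢xs y∈xs)) x∈ys

  Unique-∷ʳ : ∀ {xs : List A} {z} → Unique xs → z ∉ xs → Unique (xs ∷ʳ z)
  Unique-∷ʳ xs! z∉xs = ++⁺ xs! ([] ∷ []) λ { (z∈xs , here refl) → z∉xs z∈xs }

  length-∷ʳ : ∀ (xs : List A) {z} → length (xs ∷ʳ z) ≡ suc (length xs)
  length-∷ʳ []       = refl
  length-∷ʳ (_ ∷ xs) = cong suc (length-∷ʳ xs)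

  data Last : List A → A → Set where
    [-]  : ∀ {a} → Last (a ∷ []) a
    skip : ∀ {a b xs} → Last xs a → Last (b ∷ xs) a

  Last-∷ʳ : ∀ xs {z : A} → Last (xs ∷ʳ z) z
  Last-∷ʳ []       = [-]
  Last-∷ʳ (_ ∷ xs) = skip (Last-∷ʳ xs)

Unique⇒length≤ : ∀ {n} {xs : List (Fin n)} → Unique xs → length xs ≤ n
Unique⇒length≤ {xs = xs} xs! =
  subst (length xs ≤_) (length-tabulate (λ i → i)) (Unique-⊆⇒length≤ xs! (λ {y} _ → ∈-allFin y))

module _ {n : ℕ} (G : Graph n) where

  end₁≢end₂ : (e : Edge G) → end₁ G e ≢ end₂ G e
  end₁≢end₂ (_ , _ , u<v , _) u≡v = <-irrefl (cong toℕ u≡v) u<v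

  Ends : Edge G → List (Fin n)
  Ends e = end₁ G e ∷ end₂ G e ∷ []

  Incident⇒∈Ends : ∀ {v} e → Incident G v e → v ∈ Ends e
  Incident⇒∈Ends _ (inj₁ v≡end₁) = here v≡end₁
  Incident⇒∈Ends _ (inj₂ v≡end₂) = there (here v≡end₂)

  incident? : ∀ v e → Dec (Incident G v e)
  incident? v e = (v ≟ end₁ G e) ⊎-dec (v ≟ end₂ G e)

  adjacent⇒edge : ∀ {u v} → T (adj G u v) → Σ[ e ∈ Edge G ] Incident G u e × Incident G v e
  adjacent⇒edge {u} {v} uv with <-cmp (toℕ u) (toℕ v)
  ... | tri< u<v _ _ = (u , v , u<v , uv) , inj₁ refl , inj₂ refl
  ... | tri> _ _ v<u = (v , u , v<u , subst T (sym G u v) uv) , inj₂ refl , inj₁ refl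
  ... | tri≈ _ u≡v _ with refl ← toℕ-injective u≡v = ⊥-elim (subst T (irrefl G u) uv)

module _ {n m : ℕ} (G : Graph n) (sel : Fin m → Edge G) where
  open CharSub G sel

  module _ {A : Set} where

    Adjacent⇒∈ : ∀ {L : List A} {p q} → Adjacent L p q → p ∈ L × q ∈ L
    Adjacent⇒∈ here      = here refl , there (here refl)
    Adjacent⇒∈ (there a) = let p∈ , q∈ = Adjacent⇒∈ a in there p∈ , there q∈

    Adjacent-++⁺ : ∀ {L ys : List A} {p q} → Adjacent L p q → Adjacent (L ++ ys) p q
    Adjacent-++⁺ here      = here
    Adjacent-++⁺ (there a) = there (Adjacent-++⁺ a)

    Last⇒Adjacent-∷ʳ : ∀ {L : List A} {e z} → Last L e → Adjacent (L ∷ʳ z) e z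
    Last⇒Adjacent-∷ʳ [-]      = here
    Last⇒Adjacent-∷ʳ (skip l) = there (Last⇒Adjacent-∷ʳ l)

    Adjacent-∷ʳ⁻ : ∀ {L : List A} {e z p q} → Last L e → Adjacent (L ∷ʳ z) p q →
                   Adjacent L p q ⊎ (p ≡ e × q ≡ z)
    Adjacent-∷ʳ⁻ [-]             here              = inj₂ (refl , refl)
    Adjacent-∷ʳ⁻ [-]             (there (there ()))
    Adjacent-∷ʳ⁻ (skip [-])      here              = inj₁ here
    Adjacent-∷ʳ⁻ (skip (skip _)) here              = inj₁ here
    Adjacent-∷ʳ⁻ (skip l)        (there a)         = Sum.map₁ there (Adjacent-∷ʳ⁻ l a)

    Star-along : ∀ {R : A → A → Set} {a ws y} →
                 (∀ {p q} → Adjacent (a ∷ ws) p q → R p q) → y ∈ a ∷ ws → Star R a y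
    Star-along              steps (here refl)  = ε
    Star-along {ws = _ ∷ _} steps (there y∈ws) =
      steps here ◅ Star-along (λ a → steps (there a)) y∈ws

  Consec-sym : ∀ {L p q} → Consec L p q → Consec L q p
  Consec-sym = Sum.swap

  Consec⇒∈ : ∀ {L p q} → Consec L p q → q ∈ L
  Consec⇒∈ (inj₁ pq) = proj₂ (Adjacent⇒∈ pq)
  Consec⇒∈ (inj₂ qp) = proj₁ (Adjacent⇒∈ qp)

  Consec-++⁺ : ∀ {L ys p q} → Consec L p q → Consec (L ++ ys) p q
  Consec-++⁺ = Sum.map Adjacent-++⁺ Adjacent-++⁺

  Joins : Fin m → Fin n → Fin n → Set
  Joins i x a = ((x ≡ end₁ G (sel i)) × (a ≡ end₂ G (sel i)))
              ⊎ ((x ≡ end₂ G (sel i)) × (a ≡ end₁ G (sel i)))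

  Joins⇒Incident : ∀ {i x a} → Joins i x a → Incident G x (sel i)
  Joins⇒Incident = Sum.map proj₁ proj₁

  Joins-functional : ∀ {i x a b} → Joins i x a → Joins i x b → a ≡ b
  Joins-functional     (inj₁ (_ , refl)) (inj₁ (_ , refl)) = refl
  Joins-functional {i} (inj₁ (refl , _)) (inj₂ (x≡ , _))   = ⊥-elim (end₁≢end₂ G (sel i) x≡)
  Joins-functional {i} (inj₂ (refl , _)) (inj₁ (x≡ , _))   = ⊥-elim (end₁≢end₂ G (sel i) (≡.sym x≡))
  Joins-functional     (inj₂ (_ , refl)) (inj₂ (_ , refl)) = refl

  HEdge-sym : ∀ {x y} → HEdge x y → HEdge y x
  HEdge-sym (i , xy) = i , Sum.swap (Sum.map swap swap xy)

  HEdge-irrefl : ∀ {x} → ¬ HEdge x x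
  HEdge-irrefl (i , inj₁ (refl , x≡)) = end₁≢end₂ G (sel i) x≡
  HEdge-irrefl (i , inj₂ (refl , x≡)) = end₁≢end₂ G (sel i) (≡.sym x≡)

  HEdge? : ∀ x y → Dec (HEdge x y)
  HEdge? x y = any? λ i → ((x ≟ end₁ G (sel i)) ×-dec (y ≟ end₂ G (sel i)))
                     ⊎-dec ((x ≟ end₂ G (sel i)) ×-dec (y ≟ end₁ G (sel i)))

  MaxDegree≤2 : Set
  MaxDegree≤2 = ∀ {x a b d} → HEdge x a → HEdge x b → HEdge x d → a ≡ b ⊎ a ≡ d ⊎ b ≡ d

  Degree≤1 : Fin n → Set
  Degree≤1 x = ∀ {a b} → HEdge x a → HEdge x b → a ≡ b

  module PathConstruction (maxDegree≤2 : MaxDegree≤2) (x : Fin n) (degree≤1 : Degree≤1 x) where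
    open import Data.List.Membership.DecPropositional (_≟_ {n}) using (_∈?_)

    -- The state of the greedy walk from x: every vertex but end already has all its H-edges
    -- on the path, and end has at most one H-neighbour off it.
    record PathPrefix : Set where
      field
        rest            : List (Fin n)
        end             : Fin n
        last            : Last (x ∷ rest) end
        unique          : Unique (x ∷ rest)
        consec⇒edge     : ∀ {y z} → Consec (x ∷ rest) y z → HEdge y z
        edge⇒consec     : ∀ {y z} → y ∈ x ∷ rest → y ≢ end → HEdge y z → Consec (x ∷ rest) y z
        fresh-neighbour : ∀ {z w} → HEdge end z → z ∉ x ∷ rest → HEdge end w →
                          z ≡ w ⊎ Consec (x ∷ rest) end w
    open PathPrefix

    Maximal : PathPrefix → Set
    Maximal s = ∀ {z} → HEdge (end s) z → z ∈ x ∷ rest s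

    start : PathPrefix
    start = record
      { rest            = []
      ; end             = x
      ; last            = [-]
      ; unique          = [] ∷ []
      ; consec⇒edge     = λ { (inj₁ (there ())) ; (inj₂ (there ())) }
      ; edge⇒consec     = λ { (here refl) x≢x _ → ⊥-elim (x≢x refl) }
      ; fresh-neighbour = λ xz _ xw → inj₁ (degree≤1 xz xw)
      }

    extend : (s : PathPrefix) {z : Fin n} → HEdge (end s) z → z ∉ x ∷ rest s → PathPrefix
    extend s {z} ez z∉L = record
      { rest            = rest s ∷ʳ z
      ; end             = z
      ; last            = Last-∷ʳ L
      ; unique          = Unique-∷ʳ (unique s) z∉L
      ; consec⇒edge     = consec⇒edge′
      ; edge⇒consec     = edge⇒consec′
      ; fresh-neighbour = fresh-neighbour′
      }
      where
      L : List (Fin n)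
      L = x ∷ rest s

      e→z : Adjacent (L ∷ʳ z) (end s) z
      e→z = Last⇒Adjacent-∷ʳ (last s)

      consec⇒edge′ : ∀ {y w} → Consec (L ∷ʳ z) y w → HEdge y w
      consec⇒edge′ (inj₁ yw) with Adjacent-∷ʳ⁻ (last s) yw
      ... | inj₁ yw′           = consec⇒edge s (inj₁ yw′)
      ... | inj₂ (refl , refl) = ez
      consec⇒edge′ (inj₂ wy) with Adjacent-∷ʳ⁻ (last s) wy
      ... | inj₁ wy′           = consec⇒edge s (inj₂ wy′)
      ... | inj₂ (refl , refl) = HEdge-sym ez

      edge⇒consec′ : ∀ {y w} → y ∈ L ∷ʳ z → y ≢ z → HEdge y w → Consec (L ∷ʳ z) y w
      edge⇒consec′ {y} y∈ y≢z yw with ∈-++⁻ L y∈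
      ... | inj₂ (here y≡z) = ⊥-elim (y≢z y≡z)
      ... | inj₁ y∈L with y ≟ end s
      ...   | no y≢e = Consec-++⁺ (edge⇒consec s y∈L y≢e yw)
      ...   | yes refl with fresh-neighbour s ez z∉L yw
      ...     | inj₁ refl = inj₁ e→z
      ...     | inj₂ ew   = Consec-++⁺ ew

      fresh-neighbour′ : ∀ {z′ w} → HEdge z z′ → z′ ∉ L ∷ʳ z → HEdge z w →
                         z′ ≡ w ⊎ Consec (L ∷ʳ z) z w
      fresh-neighbour′ zz′ z′∉ zw with maxDegree≤2 (HEdge-sym ez) zz′ zw
      ... | inj₁ refl        = ⊥-elim (z′∉ (proj₁ (Adjacent⇒∈ e→z)))
      ... | inj₂ (inj₁ refl) = inj₂ (inj₂ e→z)
      ... | inj₂ (inj₂ z′≡w) = inj₁ z′≡w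

    maximal-or-extensible : (s : PathPrefix) → Maximal s ⊎ ∃[ z ] HEdge (end s) z × z ∉ x ∷ rest s
    maximal-or-extensible s with any? (λ z → HEdge? (end s) z ×-dec ¬? (z ∈? x ∷ rest s))
    ... | yes extension = inj₂ extension
    ... | no ¬extension =
      inj₁ λ {z} ez → decidable-stable (z ∈? x ∷ rest s) (λ z∉ → ¬extension (z , ez , z∉))

    -- Every extension adds a new vertex of Fin n, so n steps of fuel suffice.
    grow : (fuel : ℕ) (s : PathPrefix) → n ≤ length (rest s) + fuel → Σ[ s ∈ PathPrefix ] Maximal s
    grow fuel s bound with maximal-or-extensible s
    ... | inj₁ maximal = s , maximal
    grow zero s bound | inj₂ (z , ez , z∉) =
      ⊥-elim (≤⇒≯ (≤-trans bound (≤-reflexive (+-identityʳ _))) too-long)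
      where
      too-long : suc (length (rest s)) ≤ n
      too-long = ≤-trans (≤-trans (n≤1+n _) (≤-reflexive (cong suc (≡.sym (length-∷ʳ (rest s))))))
                         (Unique⇒length≤ (unique (extend s ez z∉)))
    grow (suc fuel) s bound | inj₂ (z , ez , z∉) =
      grow fuel (extend s ez z∉)
        (≤-trans bound (≤-reflexive (trans (+-suc (length (rest s)) fuel)
                                           (cong (_+ fuel) (≡.sym (length-∷ʳ (rest s)))))))

    maximal⇒PathEndpoint : (s : PathPrefix) → Maximal s → PathEndpoint x
    maximal⇒PathEndpoint s maximal =
        rest s
      , unique s
      , (λ _ → mk⇔ (Star⇒∈ (here refl)) (Star-along (λ a → consec⇒edge s (inj₁ a))))
      , (λ _ _ y∈L → mk⇔ (edge⇒consec′ y∈L) (consec⇒edge s))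
      where
      L : List (Fin n)
      L = x ∷ rest s

      edge⇒consec′ : ∀ {y z} → y ∈ L → HEdge y z → Consec L y z
      edge⇒consec′ {y} {z} y∈L yz with y ≟ end s
      ... | no y≢e   = edge⇒consec s y∈L y≢e yz
      ... | yes refl = Consec-sym (edge⇒consec s (maximal yz) z≢y (HEdge-sym yz))
        where
        z≢y : z ≢ y
        z≢y z≡y = HEdge-irrefl (subst (HEdge y) z≡y yz)

      Star⇒∈ : ∀ {y w} → y ∈ L → Star HEdge y w → w ∈ L
      Star⇒∈ y∈L ε         = y∈L
      Star⇒∈ y∈L (yz ◅ zw) = Star⇒∈ (Consec⇒∈ (edge⇒consec′ y∈L yz)) zw

    pathEndpoint : PathEndpoint x
    pathEndpoint = let s , maximal = grow n start ≤-refl in maximal⇒PathEndpoint s maximal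

  degree≤1⇒PathEndpoint : MaxDegree≤2 → ∀ {x} → Degree≤1 x → PathEndpoint x
  degree≤1⇒PathEndpoint maxDegree≤2 {x} = PathConstruction.pathEndpoint maxDegree≤2 x

module Colouring {n m : ℕ} (G : Graph n) (c : Edge G → Fin m) (twoValid : TwoValid G c)
                 (sel : Fin m → Edge G) (character : IsCharacterChoice G c sel) where
  open CharSub G sel

  sel-colour-injective : ∀ {i j} → c (sel i) ≡ c (sel j) → i ≡ j
  sel-colour-injective {i} {j} eq = trans (≡.sym (character i)) (trans eq (character j))

  sameColour⇒sameNeighbour : ∀ {i j x a b} → Joins G sel i x a → Joins G sel j x b →
                             c (sel i) ≡ c (sel j) → a ≡ b
  sameColour⇒sameNeighbour xa xb eq with refl ← sel-colour-injective eq = Joins-functional G sel xa xb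

  maxDegree≤2 : MaxDegree≤2 G sel
  maxDegree≤2 {x} (i , xa) (j , xb) (k , xd) =
    Sum.map (sameColour⇒sameNeighbour xa xb)
            (Sum.map (sameColour⇒sameNeighbour xa xd) (sameColour⇒sameNeighbour xb xd))
            (twoValid x (sel i) (sel j) (sel k)
                      (Joins⇒Incident G sel xa) (Joins⇒Incident G sel xb) (Joins⇒Incident G sel xd))

  only-two-colours : ∀ {u e₀ e₁ e} → Incident G u e₀ → Incident G u e₁ → Incident G u e →
                     c e₀ ≢ c e₁ → c e₀ ≡ c e ⊎ c e₁ ≡ c e
  only-two-colours {u} {e₀} {e₁} {e} u∈e₀ u∈e₁ u∈e c₀≢c₁ with twoValid u e₀ e₁ e u∈e₀ u∈e₁ u∈e
  ... | inj₁ c₀≡c₁      = ⊥-elim (c₀≢c₁ c₀≡c₁)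
  ... | inj₂ c₀≡c⊎c₁≡c = c₀≡c⊎c₁≡c

  incident-sel-colour : ∀ {v i j} → i ≡ j → Incident G v (sel j) → Incident G v (sel i)
  incident-sel-colour {v} i≡j = subst (λ k → Incident G v (sel k)) (≡.sym i≡j)

  ¬PathEndpoint⇒incident : ∀ {v e} → Incident G v e → ¬ PathEndpoint v → Incident G v (sel (c e))
  ¬PathEndpoint⇒incident {v} {e} v∈e ¬endpoint with incident? G v (sel (c e))
  ... | yes v∈sel = v∈sel
  ... | no v∉sel  = ⊥-elim (¬endpoint (degree≤1⇒PathEndpoint G sel maxDegree≤2 degree≤1))
    where
    off-colour : ∀ {i a} → Joins G sel i v a → c e ≢ c (sel i)
    off-colour {i} va ce≡ci =
      v∉sel (incident-sel-colour (trans ce≡ci (character i)) (Joins⇒Incident G sel va))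

    degree≤1 : Degree≤1 G sel v
    degree≤1 (i , va) (j , vb)
      with twoValid v e (sel i) (sel j) v∈e (Joins⇒Incident G sel va) (Joins⇒Incident G sel vb)
    ... | inj₁ ce≡ci        = ⊥-elim (off-colour va ce≡ci)
    ... | inj₂ (inj₁ ce≡cj) = ⊥-elim (off-colour vb ce≡cj)
    ... | inj₂ (inj₂ ci≡cj) = sameColour⇒sameNeighbour va vb ci≡cj

  OnSelectedEdgeFrom : Fin n → Fin n → Set
  OnSelectedEdgeFrom u v = ∃[ e ] Incident G u e × Incident G v (sel (c e))

  𝒯-neighbour⇒OnSelectedEdgeFrom : ∀ {u v} → T (adj G u v) → InT v → OnSelectedEdgeFrom u v
  𝒯-neighbour⇒OnSelectedEdgeFrom uv (_ , ¬endpoint) =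
    let e , u∈e , v∈e = adjacent⇒edge G uv in e , u∈e , ¬PathEndpoint⇒incident v∈e ¬endpoint

  OnSelectedEdgeFrom-⊆ : ∀ {u e₀ vs} → Incident G u e₀ → All (OnSelectedEdgeFrom u) vs →
                         ∃[ b ] vs ⊆ Ends G (sel (c e₀)) ++ Ends G (sel b)
  OnSelectedEdgeFrom-⊆ {e₀ = e₀} {vs} u∈e₀ onSel with All.all? (λ v → incident? G v (sel (c e₀))) vs
  ... | yes all-a = c e₀ , λ v∈vs → ∈-++⁺ˡ (Incident⇒∈Ends G (sel (c e₀)) (All.lookup all-a v∈vs))
  ... | no ¬all-a =
    let v₁ , v₁∈vs , v₁∉a = find (¬All⇒Any¬ (λ v → incident? G v (sel (c e₀))) vs ¬all-a)
        e₁ , u∈e₁ , v₁∈b  = All.lookup onSel v₁∈vs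
        c₀≢c₁ : c e₀ ≢ c e₁
        c₀≢c₁ c₀≡c₁ = v₁∉a (incident-sel-colour c₀≡c₁ v₁∈b)
        covered : vs ⊆ Ends G (sel (c e₀)) ++ Ends G (sel (c e₁))
        covered v∈vs = let e , u∈e , v∈sel = All.lookup onSel v∈vs in
          Sum.[ (λ c₀≡c → ∈-++⁺ˡ (Incident⇒∈Ends G (sel (c e₀)) (incident-sel-colour c₀≡c v∈sel)))
              , (λ c₁≡c → ∈-++⁺ʳ (Ends G (sel (c e₀)))
                                 (Incident⇒∈Ends G (sel (c e₁)) (incident-sel-colour c₁≡c v∈sel)))
              ] (only-two-colours u∈e₀ u∈e₁ u∈e c₀≢c₁)
    in c e₁ , covered

  𝒯-neighbours-⊆ : ∀ {u v vs} → All (λ w → T (adj G u w) × InT w) (v ∷ vs) →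
                   ∃[ a ] ∃[ b ] v ∷ vs ⊆ Ends G (sel a) ++ Ends G (sel b)
  𝒯-neighbours-⊆ 𝒯-neighbours@((uv , v∈𝒯) ∷ _) =
    let e , u∈e , _ = 𝒯-neighbour⇒OnSelectedEdgeFrom uv v∈𝒯
    in c e , OnSelectedEdgeFrom-⊆ u∈e (All.map (uncurry 𝒯-neighbour⇒OnSelectedEdgeFrom) 𝒯-neighbours)

mainTheorem9 : (n k : ℕ) (G : Graph n) (m : ℕ) (c : Edge G → Fin m) →
    Surj G c → TwoValid G c → n ∸ k ≤ m →
    (sel : Fin m → Edge G) → IsCharacterChoice G c sel →
    (u : Fin n) (vs : List (Fin n)) → Unique vs →
    All (λ v → T (adj G u v) × CharSub.InT G sel v) vs →
    length vs ≤ 6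
mainTheorem9 n k G m c _ twoValid _ sel character u [] _ _ = z≤n
mainTheorem9 n k G m c _ twoValid _ sel character u (_ ∷ _) vs! 𝒯-neighbours =
  let _ , _ , covered = Colouring.𝒯-neighbours-⊆ G c twoValid sel character 𝒯-neighbours
  in ≤-trans (Unique-⊆⇒length≤ vs! covered) (m≤m+n 4 2)
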